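{- Let $G$ be a graph with an ordering $v_1,\dots,v_n$ of $V(G)$, let $\mathcal{H}=\mathcal{N}(G)$, let $i\in\{1,\dots,n-1\}$ and $I^\star\in\mathsf{MaxIrr}(\mathcal{H}_i)$. Then either $I^\star\in\mathsf{MaxIrr}(\mathcal{H}_{i+1})$, in which case $I^\star\in\mathsf{children}(I^\star,i)$; or $I^\star\cup\{v_{i+1}\}\in\mathsf{MaxIrr}(\mathcal{H}_{i+1})$, in which case $\mathsf{children}(I^\star,i)=\{I^\star\cup\{v_{i+1}\}\}$.
   Context: For a hypergraph $\mathcal{H}$, $I\subseteq V(\mathcal{H})$ and $x\in I$, $\mathsf{priv}_{\mathcal{H}}(x,I)=\{E\in\mathcal{E}(\mathcal{H}):E\cap I=\{x\}\}$; $I$ is irredundant if every $x\in I$ has a nonempty private-edge set; $\mathsf{MaxIrr}(\mathcal{H})$ is the family of inclusion-wise maximal irredundant sets. $\mathcal{N}(G)$ is the hypergraph on $V(G)$ with hyperedges $\{N[x]:x\in V(G)\}$ ($N[x]$ the closed neighborhood). With $V_i=\{v_1,\dots,v_i\}$, $\mathcal{H}_i$ is the trace of $\mathcal{H}$ on $V_i$: vertex set $V_i$ and hyperedges $\{E\cap V_i: E\in\mathcal{E}(\mathcal{H}),E\cap V_i\neq\emptyset\}$. For $i\in\{2,\dots,n\}$ and $I\in\mathsf{MaxIrr}(\mathcal{H}_i)$, $\mathsf{parent}(I,i)$ is obtained by removing $v_i$ from $I$ if present, then repeatedly adding the smallest (w.r.t. the ordering) vertex $x\in V_{i-1}\setminus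 I$ such that $I\cup\{x\}$ is irredundant in $\mathcal{H}_{i-1}$, as long as one exists. For $i\in\{1,\dots,n-1\}$ and $I^\star\in\mathsf{MaxIrr}(\mathcal{H}_i)$, $\mathsf{children}(I^\star,i)=\{I\in\mathsf{MaxIrr}(\mathcal{H}_{i+1}):\mathsf{parent}(I,i+1)=I^\star\}$. -}

module Defs where

open import Data.Bool using (Bool; true; false; _∨_)
open import Data.Nat as ℕ using (ℕ; zero; suc; _<ᵇ_)
open import Data.Fin as Fin using (Fin; toℕ; fromℕ<)
open import Data.Fin.Properties using (_≟_)
open import Data.Fin.Subset using (Subset; _∈_; _∉_; _⊆_; _∩_; _∪_; ⁅_⁆; _-_; Nonempty)
open import Data.Fin.Subset.Properties using (nonempty?)
open import Data.Vec using (tabulate)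
open import Data.List using (List; map; filter; allFin)
open import Data.List.Membership.Propositional using () renaming (_∈_ to _∈ˡ_)
open import Data.Product using (Σ; _×_; ∃)
open import Relation.Nullary using (¬_; does)
open import Relation.Binary.PropositionalEquality using (_≡_)

-- A finite simple graph on the vertex set Fin n (symmetric, irreflexive,
-- decidable adjacency).  The ordering v₁,…,vₙ of the paper is
-- v_k = the element of Fin n with toℕ = k ∸ 1.
record Graph (n : ℕ) : Set where
  field
    adj     : Fin n → Fin n → Bool
    sym     : ∀ x y → adj x y ≡ adj y x
    irrefl  : ∀ x → adj x x ≡ false
open Graph public

-- A hypergraph whose vertex set is a subset of Fin n; the hyperedge family
-- is the set of elements of the list `edges`.
record Hypergraph (n : ℕ) : Set where
  constructor hypergraph
  field
    vertices : Subset n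
    edges    : List (Subset n)
open Hypergraph public

module _ {n : ℕ} where

  N[_] : Graph n → Fin n → Subset n
  N[ G ] x = tabulate (λ y → does (x ≟ y) ∨ adj G x y)

  allV : Subset n
  allV = tabulate (λ _ → true)

  𝒩 : Graph n → Hypergraph n
  𝒩 G = hypergraph allV (map N[ G ] (allFin n))

  V : ℕ → Subset n
  V i = tabulate (λ x → toℕ x <ᵇ i)

  trace : Hypergraph n → ℕ → Hypergraph n
  trace H i = hypergraph (V i) (filter nonempty? (map (λ E → E ∩ V i) (edges H)))

  HasPrivateEdge : Hypergraph n → Subset n → Fin n → Set
  HasPrivateEdge H I x = Σ (Subset n) λ E → E ∈ˡ edges H × E ∩ I ≡ ⁅ x ⁆

  Irredundant : Hypergraph n → Subset n → Set
  Irredundant H I = I ⊆ vertices H × (∀ x → x ∈ I → HasPrivateEdge H I x)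

  MaxIrr : Hypergraph n → Subset n → Set
  MaxIrr H I = Irredundant H I × (∀ J → Irredundant H J → I ⊆ J → J ≡ I)

  Addable : Hypergraph n → Subset n → Fin n → Set
  Addable H J x = x ∈ vertices H × x ∉ J × Irredundant H (J ∪ ⁅ x ⁆)

  data Greedy (H : Hypergraph n) : Subset n → Subset n → Set where
    done : ∀ {J} → (∀ x → ¬ Addable H J x) → Greedy H J J
    step : ∀ {J K} x → Addable H J x → (∀ y → y Fin.< x → ¬ Addable H J y) →
           Greedy H (J ∪ ⁅ x ⁆) K → Greedy H J K

  -- IsParent H i i<n I P :  parent(I, i+1) = P  (paper's 1-indexed notation),
  -- where v_{i+1} = fromℕ< i<n, computed in ℋ_i = trace H i.
  IsParent : Hypergraph n → (i : ℕ) → i ℕ.< n → Subset n → Subset n → Set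
  IsParent H i i<n I P = Greedy (trace H i) (I - fromℕ< i<n) P

  Child : Hypergraph n → (i : ℕ) → i ℕ.< n → Subset n → Subset n → Set
  Child H i i<n I⋆ I = MaxIrr (trace H (suc i)) I × IsParent H i i<n I I⋆

-- Let v = v_{i+1}.  If J is irredundant in ℋ_{i+1} and contains I⋆, then J ∖ {v}
-- is irredundant in ℋ_i (a private edge E ∩ V_{i+1} of x shrinks to the private
-- edge E ∩ V_i), so by maximality J ∖ {v} = I⋆ and J is I⋆ or I⋆ ∪ {v}.  Which
-- of the two is maximal in ℋ_{i+1} depends on whether I⋆ ∪ {v} is irredundant.
-- Every child I satisfies I ∖ {v} ⊆ I⋆ since the greedy completion only adds
-- vertices, so I ⊆ I⋆ ∪ {v}, and maximality of I forces equality in the second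
-- case.  Nothing specific to neighbourhood hypergraphs (nor i ≥ 1) is used.
module Submission where

open import Defs
open import Data.Nat using (ℕ; suc; _≤_; _<_)
open import Data.Fin using (fromℕ<)
open import Data.Fin.Subset using (Subset; _∪_; ⁅_⁆)
open import Data.Product using (_×_)
open import Data.Sum using (_⊎_)
open import Function.Bundles using (_⇔_)
open import Relation.Binary.PropositionalEquality using (_≡_)

open import Data.Bool.Properties as Bool using (T-≡)
open import Data.Nat using (_<ᵇ_; s≤s⁻¹)
import Data.Nat.Properties as ℕ
open import Data.Fin as Fin using (Fin; toℕ)
import Data.Fin.Properties as Fin
open import Data.Fin.Subset using (_∈_; _∉_; _⊆_; _∩_; _─_; _-_; outside; inside)
open import Data.Fin.Subset.Properties
open import Data.Vec using (_∷_; here; there)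
import Data.Vec.Properties as Vec
open import Data.List.Relation.Unary.Any using (any?)
open import Data.List.Membership.Propositional using (find; lose) renaming (_∈_ to _∈ˡ_)
open import Data.List.Membership.Propositional.Properties using (∈-map⁺; ∈-map⁻; ∈-filter⁺; ∈-filter⁻)
open import Data.Product using (Σ; _,_; proj₁; proj₂)
open import Data.Sum using (inj₁; inj₂; [_,_]′)
open import Function using (_∘_)
open import Function.Bundles using (mk⇔; Equivalence)
open import Relation.Nullary using (¬_; Dec; yes; no; contradiction)
open import Relation.Nullary.Decidable using (map′; _×-dec_; _→-dec_)
open import Relation.Binary.PropositionalEquality using (_≢_; refl; trans; subst)
  renaming (sym to ≡-sym)

x∈p─q⇒x∉q : ∀ {n} {p q : Subset n} {x} → x ∈ p ─ q → x ∉ q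
x∈p─q⇒x∉q {p = _ ∷ _}       {outside ∷ _} here ()
x∈p─q⇒x∉q {p = inside ∷ _}  {inside ∷ _}  {Fin.zero} ()
x∈p─q⇒x∉q {p = outside ∷ _} {inside ∷ _}  {Fin.zero} ()
x∈p─q⇒x∉q {p = _ ∷ _}       {_ ∷ _}       (there x∈) (there x∈q) = x∈p─q⇒x∉q x∈ x∈q

module _ {n : ℕ} where

  x∈p-y⇒x≢y : ∀ {p : Subset n} {x y} → x ∈ p - y → x ≢ y
  x∈p-y⇒x≢y x∈ refl = x∈p─q⇒x∉q x∈ (x∈⁅x⁆ _)

  p-y⊆p : ∀ (p : Subset n) y → p - y ⊆ p
  p-y⊆p p y = p─q⊆p p ⁅ y ⁆

  y∉p⇒p-y≡p : ∀ {p : Subset n} {y} → y ∉ p → p - y ≡ p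
  y∉p⇒p-y≡p {p} {y} y∉p = ⊆-antisym (p-y⊆p p y) (λ x∈ → x∈p∧x≢y⇒x∈p-y x∈ λ { refl → y∉p x∈ })

  p-y⊆q⇒p⊆q∪⁅y⁆ : ∀ {p q : Subset n} {y} → p - y ⊆ q → p ⊆ q ∪ ⁅ y ⁆
  p-y⊆q⇒p⊆q∪⁅y⁆ {y = y} p-y⊆q {x} x∈p with x Fin.≟ y
  ... | yes refl = x∈p∪q⁺ (inj₂ (x∈⁅x⁆ y))
  ... | no x≢y   = x∈p∪q⁺ (inj₁ (p-y⊆q (x∈p∧x≢y⇒x∈p-y x∈p x≢y)))

  q⊆p∧y∈p⇒q∪⁅y⁆⊆p : ∀ {p q : Subset n} {y} → q ⊆ p → y ∈ p → q ∪ ⁅ y ⁆ ⊆ p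
  q⊆p∧y∈p⇒q∪⁅y⁆⊆p {q = q} {y} q⊆p y∈p x∈ with x∈p∪q⁻ q ⁅ y ⁆ x∈
  ... | inj₁ x∈q  = q⊆p x∈q
  ... | inj₂ x∈⁅y⁆ = subst (_∈ _) (≡-sym (x∈⁅y⁆⇒x≡y y x∈⁅y⁆)) y∈p

  [p∪⁅y⁆]-y≡p : ∀ {p : Subset n} {y} → y ∉ p → (p ∪ ⁅ y ⁆) - y ≡ p
  [p∪⁅y⁆]-y≡p {p} {y} y∉p = ⊆-antisym
    (λ x∈ → [ (λ x∈p → x∈p) , (λ x∈⁅y⁆ → contradiction (x∈⁅y⁆⇒x≡y y x∈⁅y⁆) (x∈p-y⇒x≢y x∈)) ]′
              (x∈p∪q⁻ p ⁅ y ⁆ (p-y⊆p (p ∪ ⁅ y ⁆) y x∈)))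
    (λ x∈p → x∈p∧x≢y⇒x∈p-y (x∈p∪q⁺ (inj₁ x∈p)) λ { refl → y∉p x∈p })

  p-y≡q⇒p≡q∪⁅y⁆ : ∀ {p q : Subset n} {y} → p - y ≡ q → y ∈ p → p ≡ q ∪ ⁅ y ⁆
  p-y≡q⇒p≡q∪⁅y⁆ {p} {y = y} refl y∈p =
    ⊆-antisym (p-y⊆q⇒p⊆q∪⁅y⁆ (λ x∈ → x∈)) (q⊆p∧y∈p⇒q∪⁅y⁆⊆p (p-y⊆p p y) y∈p)

  ∈V⇒< : ∀ {i} {x : Fin n} → x ∈ V i → toℕ x < i
  ∈V⇒< {i} {x} x∈ = ℕ.<ᵇ⇒< (toℕ x) i (Equivalence.from T-≡
    (trans (≡-sym (Vec.lookup∘tabulate (λ y → toℕ y <ᵇ i) x)) (Vec.[]=⇒lookup x∈)))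

  <⇒∈V : ∀ {i} {x : Fin n} → toℕ x < i → x ∈ V i
  <⇒∈V {i} {x} x<i = Vec.lookup⇒[]= x (V i)
    (trans (Vec.lookup∘tabulate (λ y → toℕ y <ᵇ i) x) (Equivalence.to T-≡ (ℕ.<⇒<ᵇ x<i)))

  ∈-trace-edges⁻ : ∀ (H : Hypergraph n) j {E} → E ∈ˡ edges (trace H j) →
                   Σ (Subset n) λ F → F ∈ˡ edges H × E ≡ F ∩ V j
  ∈-trace-edges⁻ H j E∈ = ∈-map⁻ (_∩ V j) (proj₁ (∈-filter⁻ nonempty? E∈))

  ∈-trace-edges⁺ : ∀ (H : Hypergraph n) j {F x} → F ∈ˡ edges H → x ∈ F ∩ V j →
                   F ∩ V j ∈ˡ edges (trace H j)
  ∈-trace-edges⁺ H j F∈ x∈ = ∈-filter⁺ nonempty? (∈-map⁺ (_∩ V j) F∈) (_ , x∈)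

  ∩≡⁅x⁆-shrink : ∀ {E E′ J K : Subset n} {x} → E ∩ J ≡ ⁅ x ⁆ → x ∈ E′ ∩ K →
                 E′ ∩ K ⊆ E ∩ J → E′ ∩ K ≡ ⁅ x ⁆
  ∩≡⁅x⁆-shrink {x = x} E∩J≡⁅x⁆ x∈ E′∩K⊆E∩J = ⊆-antisym
    (λ y∈ → subst (_ ∈_) E∩J≡⁅x⁆ (E′∩K⊆E∩J y∈))
    (λ y∈ → subst (_∈ _) (≡-sym (x∈⁅y⁆⇒x≡y x y∈)) x∈)

  irredundant-trace-⊆ : ∀ (H : Hypergraph n) i j {J K} → Irredundant (trace H j) J →
                        K ⊆ J → K ⊆ V i → Irredundant (trace H i) K
  irredundant-trace-⊆ H i j {J} {K} (J⊆Vj , J-priv) K⊆J K⊆Vi = K⊆Vi , K-priv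
    where
    K-priv : ∀ x → x ∈ K → HasPrivateEdge (trace H i) K x
    K-priv x x∈K with J-priv x (K⊆J x∈K)
    ... | E , E∈ , E∩J≡⁅x⁆ with ∈-trace-edges⁻ H j E∈
    ... | F , F∈ , refl = F ∩ V i , ∈-trace-edges⁺ H i F∈ x∈F∩Vi ,
                          ∩≡⁅x⁆-shrink E∩J≡⁅x⁆ (x∈p∩q⁺ (x∈F∩Vi , x∈K)) F∩Vi∩K⊆F∩Vj∩J
      where
      x∈F∩Vi : x ∈ F ∩ V i
      x∈F∩Vi = x∈p∩q⁺ (proj₁ (x∈p∩q⁻ F (V j) (proj₁ (x∈p∩q⁻ _ J
                 (subst (x ∈_) (≡-sym E∩J≡⁅x⁆) (x∈⁅x⁆ x))))) , K⊆Vi x∈K)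
      F∩Vi∩K⊆F∩Vj∩J : (F ∩ V i) ∩ K ⊆ (F ∩ V j) ∩ J
      F∩Vi∩K⊆F∩Vj∩J y∈ with x∈p∩q⁻ (F ∩ V i) K y∈
      ... | y∈F∩Vi , y∈K =
        x∈p∩q⁺ (x∈p∩q⁺ (proj₁ (x∈p∩q⁻ F (V i) y∈F∩Vi) , J⊆Vj (K⊆J y∈K)) , K⊆J y∈K)

  hasPrivateEdge? : ∀ (H : Hypergraph n) I x → Dec (HasPrivateEdge H I x)
  hasPrivateEdge? H I x =
    map′ (λ P → let E , E∈ , E∩I≡⁅x⁆ = find P in E , E∈ , E∩I≡⁅x⁆)
         (λ (E , E∈ , E∩I≡⁅x⁆) → lose E∈ E∩I≡⁅x⁆)
         (any? (λ E → Vec.≡-dec Bool._≟_ (E ∩ I) ⁅ x ⁆) (edges H))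

  irredundant? : ∀ (H : Hypergraph n) I → Dec (Irredundant H I)
  irredundant? H I =
    (I ⊆? vertices H) ×-dec Fin.all? (λ x → (x ∈? I) →-dec hasPrivateEdge? H I x)

  Greedy⇒⊆ : ∀ {H : Hypergraph n} {J K} → Greedy H J K → J ⊆ K
  Greedy⇒⊆ (done _)         x∈ = x∈
  Greedy⇒⊆ (step _ _ _ gr) x∈ = Greedy⇒⊆ gr (x∈p∪q⁺ (inj₁ x∈))

  MaxIrr⇒Greedy-done : ∀ {H : Hypergraph n} {J} → MaxIrr H J → Greedy H J J
  MaxIrr⇒Greedy-done (_ , J-max) = done λ x (_ , x∉J , J∪⁅x⁆-irr) →
    x∉J (subst (x ∈_) (J-max _ J∪⁅x⁆-irr (p⊆p∪q ⁅ x ⁆)) (x∈p∪q⁺ (inj₂ (x∈⁅x⁆ x))))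

  fromℕ<∉V : ∀ {i} (i<n : i < n) → fromℕ< i<n ∉ V i
  fromℕ<∉V i<n v∈ = ℕ.<-irrefl (Fin.toℕ-fromℕ< i<n) (∈V⇒< v∈)

  V⊆V-suc : ∀ {i} → V i ⊆ V (suc i)
  V⊆V-suc x∈ = <⇒∈V (ℕ.m<n⇒m<1+n (∈V⇒< x∈))

  V-suc-fromℕ< : ∀ {i} (i<n : i < n) {x} → x ∈ V (suc i) → x ≢ fromℕ< i<n → x ∈ V i
  V-suc-fromℕ< i<n x∈ x≢v = <⇒∈V (ℕ.≤∧≢⇒< (s≤s⁻¹ (∈V⇒< x∈))
    (λ x≡i → x≢v (Fin.toℕ-injective (trans x≡i (≡-sym (Fin.toℕ-fromℕ< i<n))))))

module Extension {n} (H : Hypergraph n) {i} (i<n : i < n) {I⋆} (I⋆-max : MaxIrr (trace H i) I⋆) where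

  private
    v = fromℕ< i<n
    Hᵢ = trace H i
    Hᵢ₊₁ = trace H (suc i)

  v∉I⋆ : v ∉ I⋆
  v∉I⋆ = fromℕ<∉V i<n ∘ proj₁ (proj₁ I⋆-max)

  I⋆-irredundant : Irredundant Hᵢ₊₁ I⋆
  I⋆-irredundant = irredundant-trace-⊆ H (suc i) i (proj₁ I⋆-max) (λ x∈ → x∈)
    (V⊆V-suc ∘ proj₁ (proj₁ I⋆-max))

  -v-irredundant : ∀ {J} → Irredundant Hᵢ₊₁ J → Irredundant Hᵢ (J - v)
  -v-irredundant {J} J-irr = irredundant-trace-⊆ H i (suc i) J-irr (p-y⊆p J v)
    (λ x∈ → V-suc-fromℕ< i<n (proj₁ J-irr (p-y⊆p J v x∈)) (x∈p-y⇒x≢y x∈))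

  ⊇I⋆⇒-v≡I⋆ : ∀ {J} → Irredundant Hᵢ₊₁ J → I⋆ ⊆ J → J - v ≡ I⋆
  ⊇I⋆⇒-v≡I⋆ {J} J-irr I⋆⊆J = proj₂ I⋆-max (J - v) (-v-irredundant J-irr)
    (λ x∈ → x∈p∧x≢y⇒x∈p-y (I⋆⊆J x∈) λ { refl → v∉I⋆ x∈ })

  irredundant-⊇I⋆ : ∀ {J} → Irredundant Hᵢ₊₁ J → I⋆ ⊆ J → J ≡ I⋆ ⊎ J ≡ I⋆ ∪ ⁅ v ⁆
  irredundant-⊇I⋆ {J} J-irr I⋆⊆J with v ∈? J
  ... | yes v∈J = inj₂ (p-y≡q⇒p≡q∪⁅y⁆ (⊇I⋆⇒-v≡I⋆ J-irr I⋆⊆J) v∈J)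
  ... | no  v∉J = inj₁ (trans (≡-sym (y∉p⇒p-y≡p v∉J)) (⊇I⋆⇒-v≡I⋆ J-irr I⋆⊆J))

  I⋆-maximal : ¬ Irredundant Hᵢ₊₁ (I⋆ ∪ ⁅ v ⁆) → MaxIrr Hᵢ₊₁ I⋆
  I⋆-maximal ¬I⋆∪v-irr = I⋆-irredundant , λ J J-irr I⋆⊆J →
    [ (λ J≡I⋆ → J≡I⋆)
    , (λ J≡I⋆∪v → contradiction (subst (Irredundant Hᵢ₊₁) J≡I⋆∪v J-irr) ¬I⋆∪v-irr)
    ]′ (irredundant-⊇I⋆ J-irr I⋆⊆J)

  I⋆∪v-maximal : Irredundant Hᵢ₊₁ (I⋆ ∪ ⁅ v ⁆) → MaxIrr Hᵢ₊₁ (I⋆ ∪ ⁅ v ⁆)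
  I⋆∪v-maximal I⋆∪v-irr = I⋆∪v-irr , λ J J-irr I⋆∪v⊆J →
    [ (λ J≡I⋆ → contradiction (subst (v ∈_) J≡I⋆ (I⋆∪v⊆J (x∈p∪q⁺ (inj₂ (x∈⁅x⁆ v))))) v∉I⋆)
    , (λ J≡I⋆∪v → J≡I⋆∪v)
    ]′ (irredundant-⊇I⋆ J-irr (I⋆∪v⊆J ∘ p⊆p∪q ⁅ v ⁆))

  isParent : ∀ {J} → J - v ≡ I⋆ → IsParent H i i<n J I⋆
  isParent J-v≡I⋆ = subst (λ S → Greedy Hᵢ S I⋆) (≡-sym J-v≡I⋆) (MaxIrr⇒Greedy-done I⋆-max)

  Child⇒⊆I⋆∪v : ∀ {I} → Child H i i<n I⋆ I → I ⊆ I⋆ ∪ ⁅ v ⁆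
  Child⇒⊆I⋆∪v (_ , I-greedy) = p-y⊆q⇒p⊆q∪⁅y⁆ (Greedy⇒⊆ I-greedy)

lemma8 : ∀ {n} (G : Graph n) (i : ℕ) (1≤i : 1 ≤ i) (i<n : i < n) (I⋆ : Subset n) →
         MaxIrr (trace (𝒩 G) i) I⋆ →
         (MaxIrr (trace (𝒩 G) (suc i)) I⋆ × Child (𝒩 G) i i<n I⋆ I⋆)
         ⊎ (MaxIrr (trace (𝒩 G) (suc i)) (I⋆ ∪ ⁅ fromℕ< i<n ⁆)
            × (∀ I → Child (𝒩 G) i i<n I⋆ I ⇔ (I ≡ I⋆ ∪ ⁅ fromℕ< i<n ⁆)))
lemma8 G i _ i<n I⋆ I⋆-max with irredundant? (trace (𝒩 G) (suc i)) (I⋆ ∪ ⁅ fromℕ< i<n ⁆)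
... | no ¬I⋆∪v-irr =
  inj₁ (I⋆-maximal ¬I⋆∪v-irr , I⋆-maximal ¬I⋆∪v-irr , isParent (y∉p⇒p-y≡p v∉I⋆))
  where open Extension (𝒩 G) i<n I⋆-max
... | yes I⋆∪v-irr = inj₂ (I⋆∪v-maximal I⋆∪v-irr , λ I → mk⇔
  (λ I-child → ≡-sym (proj₂ (proj₁ I-child) _ I⋆∪v-irr (Child⇒⊆I⋆∪v I-child)))
  (λ { refl → I⋆∪v-maximal I⋆∪v-irr , isParent ([p∪⁅y⁆]-y≡p v∉I⋆) }))
  where open Extension (𝒩 G) i<n I⋆-max
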